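{- Let $G$ be a graph with discrete node set, $x,y$ nodes and $w:\mathsf{W}_G(x,y)$. Then (1) the type $\mathsf{Reduce}(w)$ is decidable; (2) the proposition $\mathsf{Normal}(w)$ is decidable; (3) $w$ progresses, i.e. $\mathsf{Reduce}(w)+\mathsf{Normal}(w)$ is inhabited.
   Context: Setting: homotopy type theory. A graph $G$: a set $\mathsf{N}_G$ of nodes (discrete = decidable equality) and sets $\mathsf{E}_G(x,y)$ of edges. Walks: inductive family $\mathsf{W}_G(x,y)$ with $\langle x\rangle:\mathsf{W}_G(x,x)$ and $e\odot w:\mathsf{W}_G(x,z)$ for $e:\mathsf{E}_G(x,y)$, $w:\mathsf{W}_G(y,z)$; $\cdot$ concatenation; $\mathsf{length}$ counts edges. $y\in\langle z\rangle:\equiv\mathbb{0}$, $y\in(e\odot w):\equiv(y=\mathsf{source}(e))+(y\in w)$; $\mathsf{isQuasi}(w):\equiv\prod_z\mathsf{isProp}(z\in w)$. For $w:\mathsf{W}_G(x,y)$: $\mathsf{Loop}(w)$ means $x=y$; $\mathsf{Trivial}(w)$ means length $0$; $\mathsf{NonTrivial}(w)$ means $w=e\odot w'$ for some $e,w'$; $\mathsf{NonTrivialLoop}(w)$ means $w=e\odot w'$ and $x=y$. The loop-reduction relation $\rightsquigarrow$ is generated by: ($\xi_1$) $\mathsf{NonTrivialLoop}(p)$, $\mathsf{Trivial}(q)$ give $p\rightsquigarrow q$; ($\xi_2$) $e:\mathsf{E}_G(x,y)$, $p,q:\mathsf{W}_G(y,z)$, $\neg\mathsf{Loop}(e\odot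 p)$, $x\neq y$, $p\rightsquigarrow q$ give $e\odot p\rightsquigarrow e\odot q$; ($\xi_3$) $e:\mathsf{E}_G(x,y)$, $p:\mathsf{W}_G(y,x)$, $q:\mathsf{W}_G(x,z)$, $\neg\mathsf{Loop}((e\odot p)\cdot q)$, $\mathsf{Loop}(e\odot p)$, $\mathsf{NonTrivial}(q)$, $w:\mathsf{W}_G(x,z)$ with $w=(e\odot p)\cdot q$ give $w\rightsquigarrow q$. $\mathsf{Reduce}(p):\equiv\sum_q(p\rightsquigarrow q)$; $\mathsf{Normal}(p):\equiv\mathsf{isQuasi}(p)\times\neg\mathsf{Reduce}(p)$. A type $A$ is decidable if $A+\neg A$ is inhabited. -}

module Defs where

open import Data.Nat using (ℕ; zero; suc)
open import Data.Empty using (⊥)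
open import Data.Sum using (_⊎_)
open import Data.Product using (Σ; Σ-syntax; _×_)
open import Relation.Nullary using (¬_)
open import Relation.Binary.PropositionalEquality using (_≡_; _≢_)
open import Relation.Binary.Definitions using (DecidableEquality)

record Graph : Set₁ where
  field
    Node    : Set
    _≟N_    : DecidableEquality Node
    Edge    : Node → Node → Set

isProp : Set → Set
isProp A = (a b : A) → a ≡ b

module _ (G : Graph) where
  open Graph G

  data W : Node → Node → Set where
    ⟨_⟩  : (x : Node) → W x x
    _⊙_ : {x y z : Node} → Edge x y → W y z → W x z

  infixr 5 _⊙_

  _·_ : {x y z : Node} → W x y → W y z → W x z
  ⟨ _ ⟩ · v = v
  (e ⊙ w) · v = e ⊙ (w · v)

  length : {x y : Node} → W x y → ℕ
  length ⟨ _ ⟩ = zero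
  length (e ⊙ w) = suc (length w)

  _∈_ : {x z : Node} → Node → W x z → Set
  y ∈ ⟨ _ ⟩ = ⊥
  _∈_ {x} y (e ⊙ w) = (y ≡ x) ⊎ (y ∈ w)

  isQuasi : {x y : Node} → W x y → Set
  isQuasi w = (z : Node) → isProp (z ∈ w)

  Loop : {x y : Node} → W x y → Set
  Loop {x} {y} _ = x ≡ y

  Trivial : {x y : Node} → W x y → Set
  Trivial w = length w ≡ 0

  NonTrivial : {x y : Node} → W x y → Set
  NonTrivial {x} {z} w = Σ[ y ∈ Node ] Σ[ e ∈ Edge x y ] Σ[ w' ∈ W y z ] (w ≡ e ⊙ w')

  NonTrivialLoop : {x y : Node} → W x y → Set
  NonTrivialLoop {x} {y} w = NonTrivial w × (x ≡ y)

  data _⇝_ : {x z : Node} → W x z → W x z → Set where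
    ξ₁ : {x y : Node} {p q : W x y} → NonTrivialLoop p → Trivial q → p ⇝ q
    ξ₂ : {x y z : Node} (e : Edge x y) (p q : W y z)
       → ¬ Loop (e ⊙ p) → x ≢ y → p ⇝ q → (e ⊙ p) ⇝ (e ⊙ q)
    ξ₃ : {x y z : Node} (e : Edge x y) (p : W y x) (q : W x z)
       → ¬ Loop ((e ⊙ p) · q) → Loop (e ⊙ p) → NonTrivial q
       → (w : W x z) → w ≡ (e ⊙ p) · q → w ⇝ q

  Reduce : {x y : Node} → W x y → Set
  Reduce {x} {y} p = Σ[ q ∈ W x y ] (p ⇝ q)

  Normal : {x y : Node} → W x y → Set
  Normal p = isQuasi p × ¬ Reduce p

{-# OPTIONS --safe #-}
module Submission where

open import Defs
open import Axiom.UniquenessOfIdentityProofs using (module Decidable⇒UIP)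
open import Data.Empty using (⊥-elim)
open import Data.Product using (_×_; Σ-syntax; _,_)
open import Data.Sum using (_⊎_; inj₁; inj₂)
open import Relation.Nullary using (Dec; yes; no; ¬_)
open import Relation.Nullary.Decidable using (map′)
open import Relation.Binary.PropositionalEquality using (_≡_; refl; _≢_; subst)

-- A walk e ⊙ p from x to z is analysed by its first node x. If x = z it
-- reduces by ξ₁; if x ≠ z but x reappears in p it reduces by ξ₃; otherwise
-- only ξ₂ applies, so e ⊙ p reduces exactly when p does. This decides
-- reducibility by induction on the walk, and shows that an irreducible walk
-- visits no node twice, hence is quasi.

isProp-⊎ : {A B : Set} → isProp A → isProp B → (A → ¬ B) → isProp (A ⊎ B)
isProp-⊎ isPropA isPropB disjoint (inj₁ a) (inj₁ a′) rewrite isPropA a a′ = refl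
isProp-⊎ isPropA isPropB disjoint (inj₁ a) (inj₂ b)  = ⊥-elim (disjoint a b)
isProp-⊎ isPropA isPropB disjoint (inj₂ b) (inj₁ a)  = ⊥-elim (disjoint a b)
isProp-⊎ isPropA isPropB disjoint (inj₂ b) (inj₂ b′) rewrite isPropB b b′ = refl

module _ (G : Graph) where
  open Graph G

  private
    _∈W_ : ∀ {x z} → Node → W G x z → Set
    _∈W_ = _∈_ G

  _∈?_ : ∀ {y z} (a : Node) (p : W G y z) → Dec (a ∈W p)
  a ∈? ⟨ _ ⟩ = no λ ()
  a ∈? (_⊙_ {x} e p) with a ≟N x | a ∈? p
  ... | yes a≡x | _       = yes (inj₁ a≡x)
  ... | no _    | yes a∈p = yes (inj₂ a∈p)
  ... | no a≢x  | no a∉p  = no λ { (inj₁ a≡x) → a≢x a≡x ; (inj₂ a∈p) → a∉p a∈p }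

  ∈⇒split : ∀ {x y z} (p : W G y z) → x ∈W p
          → Σ[ p′ ∈ W G y x ] Σ[ q ∈ W G x z ] NonTrivial G q × p ≡ _·_ G p′ q
  ∈⇒split (e ⊙ p) (inj₁ refl) = ⟨ _ ⟩ , e ⊙ p , (_ , e , p , refl) , refl
  ∈⇒split (e ⊙ p) (inj₂ x∈p) with ∈⇒split p x∈p
  ... | p′ , q , q-nontrivial , refl = e ⊙ p′ , q , q-nontrivial , refl

  ∈-·-NonTrivial : ∀ {x y z} (p : W G y x) (q : W G x z) → NonTrivial G q → x ∈W _·_ G p q
  ∈-·-NonTrivial ⟨ _ ⟩   .(e ⊙ q) (_ , e , q , refl) = inj₁ refl
  ∈-·-NonTrivial (e ⊙ p) q        q-nontrivial       = inj₂ (∈-·-NonTrivial p q q-nontrivial)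

  source-∈ : ∀ {y z} (p : W G y z) → y ≢ z → y ∈W p
  source-∈ ⟨ _ ⟩   y≢y = ⊥-elim (y≢y refl)
  source-∈ (e ⊙ p) _   = inj₁ refl

  ¬Reduce-⟨⟩ : ∀ {x} → ¬ Reduce G ⟨ x ⟩
  ¬Reduce-⟨⟩ (_ , ξ₁ ((_ , _ , _ , ()) , _) _)
  ¬Reduce-⟨⟩ (_ , ξ₃ _ _ _ _ _ _ _ ())

  module _ {x y z} (e : Edge x y) (p : W G y z) where

    Reduce-⊙-loop : x ≡ z → Reduce G (e ⊙ p)
    Reduce-⊙-loop refl = ⟨ x ⟩ , ξ₁ ((_ , e , p , refl) , refl) refl

    Reduce-⊙-revisit : x ≢ z → x ∈W p → Reduce G (e ⊙ p)
    Reduce-⊙-revisit x≢z x∈p with ∈⇒split p x∈p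
    ... | p′ , q , q-nontrivial , refl =
      q , ξ₃ e p′ q x≢z refl q-nontrivial (e ⊙ _·_ G p′ q) refl

    Reduce-⊙ : x ≢ z → ¬ x ∈W p → Reduce G p → Reduce G (e ⊙ p)
    Reduce-⊙ x≢z x∉p (q , p⇝q) = e ⊙ q , ξ₂ e p q x≢z x≢y p⇝q
      where
      x≢y : x ≢ y
      x≢y refl = x∉p (source-∈ p x≢z)

    Reduce-⊙⁻¹ : x ≢ z → ¬ x ∈W p → Reduce G (e ⊙ p) → Reduce G p
    Reduce-⊙⁻¹ x≢z x∉p (_ , ξ₁ (_ , x≡z) _)                  = ⊥-elim (x≢z x≡z)
    Reduce-⊙⁻¹ x≢z x∉p (_ , ξ₂ _ _ q _ _ p⇝q)               = q , p⇝q
    Reduce-⊙⁻¹ x≢z x∉p (_ , ξ₃ _ p′ q _ _ q-nontrivial _ refl) =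
      ⊥-elim (x∉p (∈-·-NonTrivial p′ q q-nontrivial))

    ¬Reduce-⊙⇒ : ¬ Reduce G (e ⊙ p) → x ≢ z × ¬ x ∈W p × ¬ Reduce G p
    ¬Reduce-⊙⇒ irreducible = x≢z , x∉p , λ r → irreducible (Reduce-⊙ x≢z x∉p r)
      where
      x≢z : x ≢ z
      x≢z x≡z = irreducible (Reduce-⊙-loop x≡z)
      x∉p : ¬ x ∈W p
      x∉p x∈p = irreducible (Reduce-⊙-revisit x≢z x∈p)

  reduce? : ∀ {x z} (w : W G x z) → Dec (Reduce G w)
  reduce? ⟨ _ ⟩ = no ¬Reduce-⟨⟩
  reduce? {x} {z} (e ⊙ p) with x ≟N z
  ... | yes x≡z = yes (Reduce-⊙-loop e p x≡z)
  ... | no x≢z with x ∈? p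
  ...   | yes x∈p = yes (Reduce-⊙-revisit e p x≢z x∈p)
  ...   | no x∉p  = map′ (Reduce-⊙ e p x≢z x∉p) (Reduce-⊙⁻¹ e p x≢z x∉p) (reduce? p)

  ¬Reduce⇒isQuasi : ∀ {x z} (w : W G x z) → ¬ Reduce G w → isQuasi G w
  ¬Reduce⇒isQuasi ⟨ _ ⟩ _ a ()
  ¬Reduce⇒isQuasi (e ⊙ p) irreducible a with ¬Reduce-⊙⇒ e p irreducible
  ... | _ , x∉p , p-irreducible =
    isProp-⊎ (Decidable⇒UIP.≡-irrelevant _≟N_)
             (¬Reduce⇒isQuasi p p-irreducible a)
             (λ a≡x a∈p → x∉p (subst (_∈W p) a≡x a∈p))

  progress : ∀ {x z} (w : W G x z) → Reduce G w ⊎ Normal G w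
  progress w with reduce? w
  ... | yes reducible   = inj₁ reducible
  ... | no irreducible = inj₂ (¬Reduce⇒isQuasi w irreducible , irreducible)

  normal? : ∀ {x z} (w : W G x z) → Dec (Normal G w)
  normal? w with progress w
  ... | inj₁ reducible = no λ (_ , irreducible) → irreducible reducible
  ... | inj₂ normal    = yes normal

corollary4p41 : (G : Graph) (x y : Graph.Node G) (w : W G x y)
    → Dec (Reduce G w) × Dec (Normal G w) × (Reduce G w ⊎ Normal G w)
corollary4p41 G x y w = reduce? G w , normal? G w , progress G w
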